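{- Let $n>2$ and $S=\{f,rf,r^2f\}\subseteq D_n$. Then $S$ generates $D_n$ and $\lambda_1(D_n,S)\le\lfloor n/2\rfloor+1$.
   Context: The dihedral group $D_n$ is the group of order $2n$ with presentation $\langle r,f\mid r^n=f^2=1,\ rf=fr^{ -1}\rangle$. For a generating set $S$ of a finite group $G$ and $g\in G$, $l_S(g)$ is the minimal number of factors in an expression of $g$ as a product of elements of $S$ ($l_S(1)=0$). Define $\lambda_1(G,S)=\max_{g\in G,\,s\in S} l_S(gsg^{ -1})$. $\lfloor x\rfloor$ is the greatest integer $\le x$. -}

module Defs where

open import Data.Nat using (ℕ; zero; suc; _+_; _∸_; _≤_; NonZero)
open import Data.Nat.DivMod using (_mod_)
open import Data.Fin using (Fin; toℕ)
open import Data.Bool using (Bool; true; false; _xor_)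
open import Data.List using (List; []; _∷_; foldr; length)
open import Data.List.Relation.Unary.All using (All)
open import Data.List.Membership.Propositional using (_∈_)
open import Data.Product using (∃-syntax; _×_)
open import Relation.Binary.PropositionalEquality using (_≡_)

-- The dihedral group D_n of order 2n, modelled concretely:
-- the element  ⟨ k , b ⟩  stands for  r^k f^b  (k mod n, b ∈ {0,1}).
record Dih (n : ℕ) : Set where
  constructor ⟨_,_⟩
  field
    rot  : Fin n
    flp  : Bool

module _ (n : ℕ) .{{_ : NonZero n}} where

  _⊕_ : Fin n → Fin n → Fin n
  a ⊕ c = (toℕ a + toℕ c) mod n

  ⊖_ : Fin n → Fin n
  ⊖ a = (n ∸ toℕ a) mod n

  -- (r^a f^b)(r^c f^d) = r^(a + (-1)^b c) f^(b xor d),  using f r = r^{-1} f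
  mul : Dih n → Dih n → Dih n
  mul ⟨ a , false ⟩ ⟨ c , d ⟩ = ⟨ a ⊕ c , d ⟩
  mul ⟨ a , true  ⟩ ⟨ c , d ⟩ = ⟨ a ⊕ (⊖ c) , true xor d ⟩

  one : Dih n
  one = ⟨ 0 mod n , false ⟩

  inv : Dih n → Dih n
  inv ⟨ a , false ⟩ = ⟨ ⊖ a , false ⟩
  inv ⟨ a , true  ⟩ = ⟨ a , true ⟩

  r : Dih n
  r = ⟨ 1 mod n , false ⟩

  f : Dih n
  f = ⟨ 0 mod n , true ⟩

  S : List (Dih n)
  S = f ∷ mul r f ∷ mul r (mul r f) ∷ []

  prod : List (Dih n) → Dih n
  prod = foldr mul one

  InSpan : List (Dih n) → Dih n → Set
  InSpan T g = ∃[ w ] (All (_∈ T) w × prod w ≡ g)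

  LengthAtMost : List (Dih n) → Dih n → ℕ → Set
  LengthAtMost T g m = ∃[ w ] (All (_∈ T) w × length w ≤ m × prod w ≡ g)

  Generates : List (Dih n) → Set
  Generates T = (g : Dih n) → InSpan T g

  Lambda1AtMost : List (Dih n) → ℕ → Set
  Lambda1AtMost T m =
    (g : Dih n) → (s : Dih n) → s ∈ T → LengthAtMost T (mul (mul g s) (inv g)) m

module Submission where

-- Write s₀ = f, s₁ = rf, s₂ = r²f, and let  x̂ = r^x f  denote the reflection
-- with rotation part x ∈ ℤ/n.  For reflections  α̂ β̂ x̂ = (α - β + x)^,  so the
-- alternating word  (â b̂)^t ĉ  of length 2t+1 is the reflection y with
-- y + t·b = t·a + c.  With (a,b) = (2,0) this reaches every residue 2t+e,
-- with (a,b) = (0,2) every residue e-2t (e ≤ 2).  Splitting a residue K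
-- either way in ℕ shows that every reflection has S-length ≤ ⌊n/2⌋+1.
-- A conjugate of a reflection is a reflection, which bounds λ₁; and every
-- rotation is s₀ times a reflection, so S generates D_n.

open import Defs
open import Algebra.Bundles using (AbelianGroup)
open import Algebra.Structures using (IsAbelianGroup)
open import Algebra.Consequences.Propositional using (comm∧idˡ⇒id; comm∧invˡ⇒inv)
import Algebra.Properties.AbelianGroup as AbelianGroupProperties
import Algebra.Properties.CommutativeSemigroup as CommutativeSemigroupProperties
open import Data.Bool using (true; false)
open import Data.Fin using (Fin; toℕ)
open import Data.Fin.Properties using (toℕ-fromℕ<; toℕ-injective; toℕ<n)
open import Data.List using (List; []; _∷_; length)
open import Data.List.Membership.Propositional using (_∈_)
open import Data.List.Relation.Unary.All using (All; []; _∷_)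
open import Data.List.Relation.Unary.Any using (here; there)
open import Data.Nat using (ℕ; zero; suc; _+_; _*_; _∸_; _≤_; _<_; z≤n; s≤s; NonZero; _%_; _/_; _≤?_)
open import Data.Nat.DivMod using (_mod_; %-distribˡ-+; n%n≡0; m<n⇒m%n≡m; m%n<n; m≡m%n+[m/n]*n)
open import Data.Nat.Properties
  using (module ≤-Reasoning; +-assoc; +-comm; +-suc; *-comm; *-zeroʳ; +-identityʳ;
         <⇒≤; ≤-trans; ≤-reflexive; ≤-pred; m∸n+n≡m; m+[n∸m]≡n; ∸-monoˡ-≤; +-monoˡ-≤;
         +-cancelˡ-≤; ≰⇒>)
open import Data.Product using (Σ; ∃-syntax; _×_; _,_)
open import Relation.Binary.PropositionalEquality
  using (_≡_; refl; sym; trans; cong; cong₂; subst; module ≡-Reasoning)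
open import Relation.Binary.PropositionalEquality.Algebra using (isMagma)
open import Relation.Nullary using (yes; no)

-- K = 2t + e with e ≤ 2 and 2t ≤ K - 1, so that the word (s₂ s₀)^t sₑ for
-- r^K f has length 2t + 1 ≤ max(K, 1).
split-below : ∀ K → ∃[ t ] ∃[ e ] (e ≤ 2 × t * 2 + e ≡ K × t * 2 ≤ K ∸ 1)
split-below 0 = 0 , 0 , z≤n , refl , z≤n
split-below 1 = 0 , 1 , s≤s z≤n , refl , z≤n
split-below 2 = 0 , 2 , s≤s (s≤s z≤n) , refl , z≤n
split-below (suc (suc (suc K))) with split-below (suc K)
... | t , e , e≤2 , sum≡ , bound = suc t , e , e≤2 , cong (λ m → suc (suc m)) sum≡ , s≤s (s≤s bound)

-- 2t = j + e with e ≤ 2 and 2t ≤ j + 1: the word (s₀ s₂)^t sₑ reaches r^(-j) f.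
split-above : ∀ j → ∃[ t ] ∃[ e ] (e ≤ 2 × t * 2 ≡ j + e × t * 2 ≤ suc j)
split-above 0 = 0 , 0 , z≤n , refl , z≤n
split-above 1 = 1 , 1 , s≤s z≤n , refl , s≤s (s≤s z≤n)
split-above (suc (suc j)) with split-above j
... | t , e , e≤2 , double≡ , bound = suc t , e , e≤2 , cong (λ m → suc (suc m)) double≡ , s≤s (s≤s bound)

≤-double-half : ∀ n → n ≤ suc (n / 2 * 2)
≤-double-half n = ≤-trans (≤-reflexive (m≡m%n+[m/n]*n n 2)) (+-monoˡ-≤ (n / 2 * 2) (≤-pred (m%n<n n 2)))

complement-bound : ∀ {h K j n} → suc (suc h) ≤ K → K + j ≡ n → n ≤ suc (h * 2) → suc j ≤ h
complement-bound {h} {K} {j} {n} h+2≤K K+j≡n n≤2h+1 = +-cancelˡ-≤ h (suc j) h (≤-pred (begin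
  suc (h + suc j)   ≡⟨ cong suc (+-suc h j) ⟩
  suc (suc h) + j   ≤⟨ +-monoˡ-≤ j h+2≤K ⟩
  K + j             ≡⟨ K+j≡n ⟩
  n                 ≤⟨ n≤2h+1 ⟩
  suc (h * 2)       ≡⟨ cong suc (trans (*-comm h 2) (cong (h +_) (+-identityʳ h))) ⟩
  suc (h + h)       ∎))
  where open ≤-Reasoning

module _ (k : ℕ) where

  N : ℕ
  N = suc k

  ⟦_⟧ : ℕ → Fin N
  ⟦ m ⟧ = m mod N

  infixl 6 _+ᶻ_
  _+ᶻ_ : Fin N → Fin N → Fin N
  a +ᶻ b = _⊕_ N a b

  -ᶻ_ : Fin N → Fin N
  -ᶻ a = ⊖_ N a

  toℕ-⟦⟧ : ∀ m → toℕ ⟦ m ⟧ ≡ m % N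
  toℕ-⟦⟧ m = toℕ-fromℕ< (m%n<n m N)

  ⟦⟧-cong : ∀ m m' → m % N ≡ m' % N → ⟦ m ⟧ ≡ ⟦ m' ⟧
  ⟦⟧-cong m m' eq = toℕ-injective (trans (toℕ-⟦⟧ m) (trans eq (sym (toℕ-⟦⟧ m'))))

  ⟦toℕ⟧ : ∀ a → ⟦ toℕ a ⟧ ≡ a
  ⟦toℕ⟧ a = toℕ-injective (trans (toℕ-⟦⟧ (toℕ a)) (m<n⇒m%n≡m (toℕ<n a)))

  ⟦⟧-homo : ∀ m m' → ⟦ m + m' ⟧ ≡ ⟦ m ⟧ +ᶻ ⟦ m' ⟧
  ⟦⟧-homo m m' = ⟦⟧-cong (m + m') (toℕ ⟦ m ⟧ + toℕ ⟦ m' ⟧) (trans (%-distribˡ-+ m m' N)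
    (sym (cong₂ (λ u v → (u + v) % N) (toℕ-⟦⟧ m) (toℕ-⟦⟧ m'))))

  ⟦N⟧ : ⟦ N ⟧ ≡ ⟦ 0 ⟧
  ⟦N⟧ = ⟦⟧-cong N 0 (n%n≡0 N)

  +ᶻ-assoc : ∀ a b c → (a +ᶻ b) +ᶻ c ≡ a +ᶻ (b +ᶻ c)
  +ᶻ-assoc a b c = begin
    ⟦ A + B ⟧ +ᶻ c        ≡⟨ cong (⟦ A + B ⟧ +ᶻ_) (sym (⟦toℕ⟧ c)) ⟩
    ⟦ A + B ⟧ +ᶻ ⟦ C ⟧    ≡⟨ sym (⟦⟧-homo (A + B) C) ⟩
    ⟦ A + B + C ⟧         ≡⟨ cong ⟦_⟧ (+-assoc A B C) ⟩
    ⟦ A + (B + C) ⟧       ≡⟨ ⟦⟧-homo A (B + C) ⟩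
    ⟦ A ⟧ +ᶻ ⟦ B + C ⟧    ≡⟨ cong (_+ᶻ ⟦ B + C ⟧) (⟦toℕ⟧ a) ⟩
    a +ᶻ (b +ᶻ c)         ∎
    where
    open ≡-Reasoning
    A = toℕ a
    B = toℕ b
    C = toℕ c

  +ᶻ-comm : ∀ a b → a +ᶻ b ≡ b +ᶻ a
  +ᶻ-comm a b = cong ⟦_⟧ (+-comm (toℕ a) (toℕ b))

  +ᶻ-identityˡ : ∀ a → ⟦ 0 ⟧ +ᶻ a ≡ a
  +ᶻ-identityˡ a = begin
    ⟦ 0 ⟧ +ᶻ a             ≡⟨ cong (⟦ 0 ⟧ +ᶻ_) (sym (⟦toℕ⟧ a)) ⟩
    ⟦ 0 ⟧ +ᶻ ⟦ toℕ a ⟧     ≡⟨ sym (⟦⟧-homo 0 (toℕ a)) ⟩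
    ⟦ toℕ a ⟧              ≡⟨ ⟦toℕ⟧ a ⟩
    a                      ∎
    where open ≡-Reasoning

  +ᶻ-inverseˡ : ∀ a → -ᶻ a +ᶻ a ≡ ⟦ 0 ⟧
  +ᶻ-inverseˡ a = begin
    ⟦ N ∸ A ⟧ +ᶻ a           ≡⟨ cong (⟦ N ∸ A ⟧ +ᶻ_) (sym (⟦toℕ⟧ a)) ⟩
    ⟦ N ∸ A ⟧ +ᶻ ⟦ A ⟧       ≡⟨ sym (⟦⟧-homo (N ∸ A) A) ⟩
    ⟦ N ∸ A + A ⟧            ≡⟨ cong ⟦_⟧ (m∸n+n≡m (<⇒≤ (toℕ<n a))) ⟩
    ⟦ N ⟧                    ≡⟨ ⟦N⟧ ⟩
    ⟦ 0 ⟧                    ∎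
    where
    open ≡-Reasoning
    A = toℕ a

  -- ℤₙ packaged as a library abelian group, to reuse its derived laws.
  ℤₙ : AbelianGroup _ _
  ℤₙ = record { isAbelianGroup = isAbelianGroup }
    where
    isAbelianGroup : IsAbelianGroup _≡_ _+ᶻ_ ⟦ 0 ⟧ -ᶻ_
    isAbelianGroup = record
      { isGroup = record
        { isMonoid = record
          { isSemigroup = record { isMagma = isMagma _+ᶻ_ ; assoc = +ᶻ-assoc }
          ; identity    = comm∧idˡ⇒id +ᶻ-comm +ᶻ-identityˡ
          }
        ; inverse = comm∧invˡ⇒inv +ᶻ-comm +ᶻ-inverseˡ
        ; ⁻¹-cong = cong -ᶻ_
        }
      ; comm = +ᶻ-comm
      }

  open AbelianGroup ℤₙ using (identityʳ)
  open AbelianGroupProperties ℤₙ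
    using (⁻¹-involutive; ⁻¹-anti-homo‿-; //-rightDividesˡ; ∙-cancelʳ)
  open CommutativeSemigroupProperties (AbelianGroup.commutativeSemigroup ℤₙ)
    using (x∙yz≈y∙xz; x∙yz≈yx∙z)

  shift : ∀ α β y z → (α +ᶻ -ᶻ β +ᶻ y) +ᶻ (β +ᶻ z) ≡ α +ᶻ (y +ᶻ z)
  shift α β y z = begin
    (α +ᶻ -ᶻ β +ᶻ y) +ᶻ (β +ᶻ z)    ≡⟨ +ᶻ-assoc (α +ᶻ -ᶻ β) y (β +ᶻ z) ⟩
    (α +ᶻ -ᶻ β) +ᶻ (y +ᶻ (β +ᶻ z))  ≡⟨ cong ((α +ᶻ -ᶻ β) +ᶻ_) (x∙yz≈y∙xz y β z) ⟩
    (α +ᶻ -ᶻ β) +ᶻ (β +ᶻ (y +ᶻ z))  ≡⟨ sym (+ᶻ-assoc (α +ᶻ -ᶻ β) β (y +ᶻ z)) ⟩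
    (α +ᶻ -ᶻ β +ᶻ β) +ᶻ (y +ᶻ z)    ≡⟨ cong (_+ᶻ (y +ᶻ z)) (//-rightDividesˡ β α) ⟩
    α +ᶻ (y +ᶻ z)                   ∎
    where open ≡-Reasoning

  reflection : Fin N → Dih N
  reflection x = ⟨ x , true ⟩

  reflection-triple : ∀ α β x →
    mul N (reflection α) (mul N (reflection β) (reflection x)) ≡ reflection (α +ᶻ -ᶻ β +ᶻ x)
  reflection-triple α β x = cong reflection (begin
    α +ᶻ -ᶻ (β +ᶻ -ᶻ x)   ≡⟨ cong (α +ᶻ_) (⁻¹-anti-homo‿- β x) ⟩
    α +ᶻ (x +ᶻ -ᶻ β)      ≡⟨ x∙yz≈yx∙z α x (-ᶻ β) ⟩
    x +ᶻ α +ᶻ -ᶻ β        ≡⟨ +ᶻ-assoc x α (-ᶻ β) ⟩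
    x +ᶻ (α +ᶻ -ᶻ β)      ≡⟨ +ᶻ-comm x (α +ᶻ -ᶻ β) ⟩
    α +ᶻ -ᶻ β +ᶻ x        ∎)
    where open ≡-Reasoning

  letter-in-S : ∀ e → e ≤ 2 → reflection ⟦ e ⟧ ∈ S N
  letter-in-S 0 _ = here refl
  letter-in-S 1 _ = there (here (cong reflection (⟦⟧-homo 1 0)))
  letter-in-S 2 _ = there (there (here (cong reflection
    (trans (⟦⟧-homo 1 1) (cong (⟦ 1 ⟧ +ᶻ_) (⟦⟧-homo 1 0))))))
  letter-in-S (suc (suc (suc _))) (s≤s (s≤s ()))

  S-reflection : ∀ {s} → s ∈ S N → Σ (Fin N) λ c → s ≡ reflection c
  S-reflection (here refl) = _ , refl
  S-reflection (there (here refl)) = _ , refl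
  S-reflection (there (there (here refl))) = _ , refl
  S-reflection (there (there (there ())))

  conjugate-reflection : ∀ g c → Σ (Fin N) λ x → mul N (mul N g (reflection c)) (inv N g) ≡ reflection x
  conjugate-reflection ⟨ a , false ⟩ c = _ , refl
  conjugate-reflection ⟨ a , true ⟩ c = _ , refl

  zigzag : Dih N → Dih N → ℕ → Dih N → List (Dih N)
  zigzag a b zero c = c ∷ []
  zigzag a b (suc t) c = a ∷ b ∷ zigzag a b t c

  zigzag-length : ∀ a b t c → length (zigzag a b t c) ≡ suc (t * 2)
  zigzag-length a b zero c = refl
  zigzag-length a b (suc t) c = cong (λ l → suc (suc l)) (zigzag-length a b t c)

  zigzag-in-S : ∀ {a b c} t → a ∈ S N → b ∈ S N → c ∈ S N → All (_∈ S N) (zigzag a b t c)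
  zigzag-in-S zero a∈ b∈ c∈ = c∈ ∷ []
  zigzag-in-S (suc t) a∈ b∈ c∈ = a∈ ∷ b∈ ∷ zigzag-in-S t a∈ b∈ c∈

  zigzag-prod : ∀ a b c t → Σ (Fin N) λ y →
    prod N (zigzag (reflection ⟦ a ⟧) (reflection ⟦ b ⟧) t (reflection ⟦ c ⟧)) ≡ reflection y
    × y +ᶻ ⟦ t * b ⟧ ≡ ⟦ t * a + c ⟧
  zigzag-prod a b c zero = _ , refl , //-rightDividesˡ ⟦ 0 ⟧ ⟦ c ⟧
  zigzag-prod a b c (suc t) with zigzag-prod a b c t
  ... | y , prod≡ , y+tb = _ ,
    trans (cong (λ g → mul N α (mul N β g)) prod≡) (reflection-triple ⟦ a ⟧ ⟦ b ⟧ y) ,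
    (begin
      ⟦ a ⟧ +ᶻ -ᶻ ⟦ b ⟧ +ᶻ y +ᶻ ⟦ b + t * b ⟧     ≡⟨ cong (⟦ a ⟧ +ᶻ -ᶻ ⟦ b ⟧ +ᶻ y +ᶻ_) (⟦⟧-homo b (t * b)) ⟩
      ⟦ a ⟧ +ᶻ -ᶻ ⟦ b ⟧ +ᶻ y +ᶻ (⟦ b ⟧ +ᶻ ⟦ t * b ⟧) ≡⟨ shift ⟦ a ⟧ ⟦ b ⟧ y ⟦ t * b ⟧ ⟩
      ⟦ a ⟧ +ᶻ (y +ᶻ ⟦ t * b ⟧)                   ≡⟨ cong (⟦ a ⟧ +ᶻ_) y+tb ⟩
      ⟦ a ⟧ +ᶻ ⟦ t * a + c ⟧                      ≡⟨ sym (⟦⟧-homo a (t * a + c)) ⟩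
      ⟦ a + (t * a + c) ⟧                         ≡⟨ cong ⟦_⟧ (sym (+-assoc a (t * a) c)) ⟩
      ⟦ a + t * a + c ⟧                           ∎)
    where
    open ≡-Reasoning
    α = reflection ⟦ a ⟧
    β = reflection ⟦ b ⟧

  short-zigzag : ∀ a b c t x → a ≤ 2 → b ≤ 2 → c ≤ 2 →
    x +ᶻ ⟦ t * b ⟧ ≡ ⟦ t * a + c ⟧ → t * 2 ≤ N / 2 →
    LengthAtMost N (S N) (reflection x) (N / 2 + 1)
  short-zigzag a b c t x a≤2 b≤2 c≤2 x+tb bound with zigzag-prod a b c t
  ... | y , prod≡ , y+tb =
    zigzag α β t γ ,
    zigzag-in-S t (letter-in-S a a≤2) (letter-in-S b b≤2) (letter-in-S c c≤2) ,
    ≤-trans (≤-reflexive (zigzag-length α β t γ))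
            (≤-trans (s≤s bound) (≤-reflexive (+-comm 1 (N / 2)))) ,
    trans prod≡ (cong reflection (∙-cancelʳ ⟦ t * b ⟧ y x (trans y+tb (sym x+tb))))
    where
    α = reflection ⟦ a ⟧
    β = reflection ⟦ b ⟧
    γ = reflection ⟦ c ⟧

  ⟦⟧-wrap : ∀ K j e → K + j ≡ N → ⟦ K + (j + e) ⟧ ≡ ⟦ e ⟧
  ⟦⟧-wrap K j e K+j≡N = begin
    ⟦ K + (j + e) ⟧    ≡⟨ cong ⟦_⟧ (trans (sym (+-assoc K j e)) (cong (_+ e) K+j≡N)) ⟩
    ⟦ N + e ⟧          ≡⟨ ⟦⟧-homo N e ⟩
    ⟦ N ⟧ +ᶻ ⟦ e ⟧     ≡⟨ cong (_+ᶻ ⟦ e ⟧) ⟦N⟧ ⟩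
    ⟦ 0 ⟧ +ᶻ ⟦ e ⟧     ≡⟨ +ᶻ-identityˡ ⟦ e ⟧ ⟩
    ⟦ e ⟧              ∎
    where open ≡-Reasoning

  -- Small residues K ≤ ⌊N/2⌋+1 are reached as 2t+e, large ones as -(N-K) = e-2t.
  reflection-short : ∀ x → LengthAtMost N (S N) (reflection x) (N / 2 + 1)
  reflection-short x with toℕ x ≤? suc (N / 2)
  ... | yes K≤h+1 with split-below (toℕ x)
  ...   | t , e , e≤2 , 2t+e≡K , 2t≤K-1 =
    short-zigzag 2 0 e t x (s≤s (s≤s z≤n)) z≤n e≤2 x+t·0 (≤-trans 2t≤K-1 (∸-monoˡ-≤ 1 K≤h+1))
    where
    open ≡-Reasoning
    x+t·0 : x +ᶻ ⟦ t * 0 ⟧ ≡ ⟦ t * 2 + e ⟧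
    x+t·0 = begin
      x +ᶻ ⟦ t * 0 ⟧   ≡⟨ cong (λ m → x +ᶻ ⟦ m ⟧) (*-zeroʳ t) ⟩
      x +ᶻ ⟦ 0 ⟧       ≡⟨ identityʳ x ⟩
      x                ≡⟨ sym (⟦toℕ⟧ x) ⟩
      ⟦ toℕ x ⟧        ≡⟨ cong ⟦_⟧ (sym 2t+e≡K) ⟩
      ⟦ t * 2 + e ⟧    ∎
  reflection-short x | no K≰h+1 with split-above (N ∸ toℕ x)
  ...   | t , e , e≤2 , 2t≡j+e , 2t≤j+1 =
    short-zigzag 0 2 e t x z≤n (s≤s (s≤s z≤n)) e≤2 x+t·2
      (≤-trans 2t≤j+1 (complement-bound (≰⇒> K≰h+1) K+j≡N (≤-double-half N)))
    where
    open ≡-Reasoning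
    K = toℕ x
    j = N ∸ K
    K+j≡N : K + j ≡ N
    K+j≡N = m+[n∸m]≡n (<⇒≤ (toℕ<n x))
    x+t·2 : x +ᶻ ⟦ t * 2 ⟧ ≡ ⟦ t * 0 + e ⟧
    x+t·2 = begin
      x +ᶻ ⟦ t * 2 ⟧       ≡⟨ cong (_+ᶻ ⟦ t * 2 ⟧) (sym (⟦toℕ⟧ x)) ⟩
      ⟦ K ⟧ +ᶻ ⟦ t * 2 ⟧   ≡⟨ sym (⟦⟧-homo K (t * 2)) ⟩
      ⟦ K + t * 2 ⟧        ≡⟨ cong (λ m → ⟦ K + m ⟧) 2t≡j+e ⟩
      ⟦ K + (j + e) ⟧      ≡⟨ ⟦⟧-wrap K j e K+j≡N ⟩
      ⟦ e ⟧                ≡⟨ cong (λ m → ⟦ m + e ⟧) (sym (*-zeroʳ t)) ⟩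
      ⟦ t * 0 + e ⟧        ∎

  -- A reflection is a word in S; a rotation r^a equals f · (r^(-a) f).
  generates : Generates N (S N)
  generates ⟨ a , true ⟩ with reflection-short a
  ... | w , w∈S , _ , prod≡ = w , w∈S , prod≡
  generates ⟨ a , false ⟩ with reflection-short (-ᶻ a)
  ... | w , w∈S , _ , prod≡ =
    f N ∷ w , here refl ∷ w∈S ,
    trans (cong (mul N (f N)) prod≡)
          (cong (λ y → ⟨ y , false ⟩) (trans (+ᶻ-identityˡ (-ᶻ -ᶻ a)) (⁻¹-involutive a)))

  -- Every conjugate g s g⁻¹ of a generator is a reflection, hence short.
  λ₁-bound : Lambda1AtMost N (S N) (N / 2 + 1)
  λ₁-bound g s s∈S with S-reflection s∈S
  ... | c , refl with conjugate-reflection g c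
  ... | x , conj≡ = subst (λ h → LengthAtMost N (S N) h (N / 2 + 1)) (sym conj≡) (reflection-short x)

lemma4 : (n : ℕ) → {{_ : NonZero n}} → 2 < n →
    Generates n (S n) × Lambda1AtMost n (S n) (n / 2 + 1)
lemma4 (suc k) _ = generates k , λ₁-bound k
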